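{- Assume Dickson's conjecture holds. Fix an integer base $B\ge 2$ and an integer $k \ge 0$. Then for every positive integer $t$ there exists a positive integer $N$ such that $N, N+1, \ldots, N+t-1$ are all $k$-frugal (base $B$).
   Context: Dickson's conjecture: for any finite family of linear polynomials $f_i(x)=a_i x+b_i$ ($i=1,\dots,t$) with integer coefficients and $a_i\ge 1$, if there is no integer $m>1$ dividing the product $f_1(x)f_2(x)\cdots f_t(x)$ for every integer $x$, then there are infinitely many positive integers $x$ for which $f_1(x),\dots,f_t(x)$ are all prime. For a positive integer $n$, $\delta(n)$ is the number of base-$B$ digits of $n$, i.e. $\delta(n)=k$ iff $B^{k-1}\le n<B^k$. Define $\delta'(a)=\delta(a)$ for $a>1$ and $\delta'(1)=0$. If $n=\prod_{i=1}^r p_i^{a_i}$ is the prime power factorisation of $n$, put $\phi(n)=\sum_{i} \big(\delta(p_i)+\delta'(a_i)\big)$ (so $\phi(1)=0$) and $h(n)=\delta(n)-\phi(n)$. For an integer $k\ge0$, $n$ is $k$-frugal if $h(n)\ge k$. -}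

module Defs where

open import Data.Nat using (ℕ; zero; suc; _+_; _*_; _^_; _≤_; _<_; _/_)
open import Data.Nat.Primality using (Prime)
open import Data.Integer as ℤ using (ℤ; +_)
open import Data.Integer.Divisibility as ℤD using ()
open import Data.List using (List; []; _∷_; foldr)
open import Data.List.Relation.Unary.All using (All)
open import Data.List.Relation.Unary.Linked using (Linked)
open import Data.Product using (_×_; _,_; ∃; ∃-syntax; proj₁)
open import Relation.Nullary using (¬_)

Linear : Set
Linear = ℕ × ℤ

eval : Linear → ℤ → ℤ
eval (a , b) x = (+ a) ℤ.* x ℤ.+ b

productAt : List Linear → ℤ → ℤ
productAt fs x = foldr (λ f acc → eval f x ℤ.* acc) (+ 1) fs

IsPrimeℤ : ℤ → Set
IsPrimeℤ z = ∃[ p ] (Prime p × z ≡ℤ + p)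
  where open import Relation.Binary.PropositionalEquality renaming (_≡_ to _≡ℤ_)

DicksonConjecture : Set
DicksonConjecture =
  (fs : List Linear) →
  All (λ f → 1 ≤ proj₁ f) fs →
  ¬ (∃[ m ] (1 < m × ((x : ℤ) → (+ m) ℤD.∣ productAt fs x))) →
  (M : ℕ) → ∃[ x ] (M < x × All (λ f → IsPrimeℤ (eval f (+ x))) fs)

-- δ(n): number of base-B digits of n (for n ≥ 1 and B ≥ 2),
-- i.e. δ n = k iff B^(k-1) ≤ n < B^k.  Computed by repeated division,
-- with fuel n (which suffices, since n / B < n for n ≥ 1, B ≥ 2).
-- For B < 2 the value is junk (never used: the theorem assumes B ≥ 2).

digitsFuel : ℕ → ℕ → ℕ → ℕ
digitsFuel b zero    m       = zero
digitsFuel b (suc f) zero    = zero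
digitsFuel b (suc f) (suc m) = suc (digitsFuel b f (suc m / suc b))

δ : (B : ℕ) → ℕ → ℕ
δ zero    n = zero
δ (suc b) n = digitsFuel b n n

δ′ : (B : ℕ) → ℕ → ℕ
δ′ B zero          = δ B zero
δ′ B (suc zero)    = zero
δ′ B (suc (suc a)) = δ B (suc (suc a))

-- Prime power factorisations: lists of pairs (p , a) meaning ∏ p^a,
-- with p prime, a ≥ 1 and the primes strictly increasing
-- (so this is THE prime power factorisation, by unique factorisation).

PrimePower : Set
PrimePower = ℕ × ℕ

evalFact : List PrimePower → ℕ
evalFact = foldr (λ { (p , a) acc → p ^ a * acc }) 1

_<ₚ_ : PrimePower → PrimePower → Set
(p , _) <ₚ (q , _) = p < q

IsPrimePowerFactorisation : ℕ → List PrimePower → Set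
IsPrimePowerFactorisation n F =
  All (λ { (p , a) → Prime p × 1 ≤ a }) F ×
  Linked _<ₚ_ F ×
  evalFact F ≡ n
  where open import Relation.Binary.PropositionalEquality using (_≡_)

φFact : (B : ℕ) → List PrimePower → ℕ
φFact B = foldr (λ { (p , a) acc → δ B p + δ′ B a + acc }) 0

-- n is k-frugal (base B) iff h(n) = δ(n) - φ(n) ≥ k, i.e. φ(n) + k ≤ δ(n),
-- where φ(n) is computed from the prime power factorisation of n.
Frugal : (B k n : ℕ) → Set
Frugal B k n =
  ∃[ F ] (IsPrimePowerFactorisation n F × φFact B F + k ≤ δ B n)

-- Take primes t + B < q 0 < q 1 < ⋯ and let D = (t !)², so that D = (i + 1) · d i for i < t. By the
-- Chinese remainder theorem choose y₀ with d i · y₀ + 1 = Q i · b i, where Q i = q i ^ e i and q i ∤ b i.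
-- With M the product of the q i ^ (e i + 1) and N = D (y₀ + M x) + 1 this gives
-- N + i = (i + 1) · Q i · (a i x + b i), where a i = d i M / Q i.
-- The t linear forms a i x + b i have no fixed prime divisor: a prime dividing D M divides no b i,
-- and any other prime exceeds t and divides no a i, so by pigeonhole some residue is a root of none.
-- Dickson's conjecture then makes every a i x + b i a prime p i > q i, and N + i = (i + 1) q i ^ e i p i
-- is k-frugal: φ(N + i) ≤ φ(i + 1) + δ(q i) + δ(e i) + δ(p i), while N + i has at least e i + δ(p i)
-- digits, and e i = B ^ (φ(i + 1) + δ(q i) + k + 1) is large enough to pay for its own δ(e i).
module Submission where

open import Defs
open import Data.Nat
open import Data.Nat.Properties
open import Algebra.Properties.CommutativeSemigroup *-commutativeSemigroup using (x∙yz≈y∙xz)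
open import Data.Nat.DivMod using (m≡m%n+[m/n]*n; m%n<n; m/n<m; m/n≡0⇒m<n; m/n*n≤m; m*[n/m]≡n)
open import Data.Nat.Divisibility
open import Data.Nat.Primality
open import Data.Nat.Coprimality using (Coprime; coprime-Bézout)
open import Data.Nat.GCD using (module Bézout)
open import Data.Nat.Induction using (<-rec)
open import Data.Nat.Tactic.RingSolver using (solve)
open import Data.Integer as ℤ using (ℤ)
import Data.Integer.Properties as ℤ
import Data.Integer.Divisibility as ℤ
open import Data.Fin as Fin using (Fin)
import Data.Fin.Properties as Fin
open import Data.List using (List; []; _∷_; _++_; last; head; applyUpTo)
open import Data.List.Membership.Propositional using (find)
open import Data.List.Membership.Propositional.Properties using (∈-applyUpTo⁻)
open import Data.List.Relation.Unary.All as All using (All)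
import Data.List.Relation.Unary.All.Properties as Allₚ
open import Data.List.Relation.Unary.Any using (Any; here; there)
open import Data.List.Relation.Unary.Linked as Linked using (Linked)
import Data.List.Relation.Unary.Linked.Properties as Linkedₚ
open import Data.Maybe.Relation.Binary.Connected using (Connected; just; nothing-just)
import Data.Maybe.Relation.Unary.All as Maybe
open import Data.Product using (_×_; _,_; proj₁; proj₂; ∃₂; ∃-syntax)
open import Data.Sum using (inj₁; inj₂; [_,_]′)
open import Function using (_∘_; id)
open import Relation.Binary.PropositionalEquality
open import Relation.Nullary using (¬_; yes; no; contradiction)

n<m^n : ∀ {m} n → 1 < m → n < m ^ n
n<m^n zero _ = s≤s z≤n
n<m^n {m} (suc n) 1<m = begin-strict
  suc n      ≤⟨ n<m^n n 1<m ⟩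
  m ^ n      <⟨ m<m*n (m ^ n) m {{m^n≢0 m n {{>-nonZero (<-trans z<s 1<m)}}}} 1<m ⟩
  m ^ n * m  ≡⟨ *-comm (m ^ n) m ⟩
  m ^ suc n  ∎
  where open ≤-Reasoning

2*[1+n]≤m^[1+n] : ∀ {m} n → 2 ≤ m → 2 * suc n ≤ m ^ suc n
2*[1+n]≤m^[1+n] {m} n 2≤m = ≤-trans (*-monoʳ-≤ 2 (n<m^n n 2≤m)) (*-monoˡ-≤ (m ^ n) 2≤m)

^-cancelˡ-< : ∀ m .{{_ : NonZero m}} {n o} → m ^ n < m ^ o → n < o
^-cancelˡ-< m {n} {o} mⁿ<mᵒ = ≰⇒> (λ o≤n → <⇒≱ mⁿ<mᵒ (^-monoʳ-≤ m o≤n))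

m∣m^n : ∀ m {n} → .{{NonZero n}} → m ∣ m ^ n
m∣m^n m {suc n} = m∣m*n (m ^ n)

m≤n⇒m∣n! : ∀ {m n} → .{{NonZero m}} → m ≤ n → m ∣ n !
m≤n⇒m∣n! {suc m} m≤n = ∣-trans (m∣m*n (m !)) (m≤n⇒m!∣n! m≤n)

∣o+m∣o+n⇒∣n∸m : ∀ {d m n} o → m ≤ n → d ∣ o + m → d ∣ o + n → d ∣ n ∸ m
∣o+m∣o+n⇒∣n∸m {d} {m} {n} o m≤n d∣o+m d∣o+n = ∣m+n∣m⇒∣n (subst (d ∣_) o+n≡o+m+[n∸m] d∣o+n) d∣o+m
  where
  open ≡-Reasoning
  o+n≡o+m+[n∸m] : o + n ≡ o + m + (n ∸ m)
  o+n≡o+m+[n∸m] = begin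
    o + n              ≡⟨ cong (o +_) (m+[n∸m]≡n m≤n) ⟨
    o + (m + (n ∸ m))  ≡⟨ +-assoc o m (n ∸ m) ⟨
    o + m + (n ∸ m)    ∎

∣o+m∣o+n⇒∣∣m-n∣ : ∀ {d m n} o → d ∣ o + m → d ∣ o + n → d ∣ ∣ m - n ∣
∣o+m∣o+n⇒∣∣m-n∣ {d} {m} {n} o d∣o+m d∣o+n with ≤-total m n
... | inj₁ m≤n = subst (d ∣_) (sym (m≤n⇒∣m-n∣≡n∸m m≤n)) (∣o+m∣o+n⇒∣n∸m o m≤n d∣o+m d∣o+n)
... | inj₂ n≤m = subst (d ∣_) (sym (m≤n⇒∣n-m∣≡n∸m n≤m)) (∣o+m∣o+n⇒∣n∸m o n≤m d∣o+n d∣o+m)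

∣∣m-n∣⇒≤m⊔n : ∀ {d m n} → m ≢ n → d ∣ ∣ m - n ∣ → d ≤ m ⊔ n
∣∣m-n∣⇒≤m⊔n {d} {m} {n} m≢n d∣∣m-n∣ =
  ≤-trans (∣⇒≤ {{≢-nonZero (m≢n ∘ ∣m-n∣≡0⇒m≡n)}} d∣∣m-n∣) (∣m-n∣≤m⊔n m n)

prime⇒2≤ : ∀ {p} → Prime p → 2 ≤ p
prime⇒2≤ {p} pp = nonTrivial⇒n>1 p {{prime⇒nonTrivial pp}}

prime∤1 : ∀ {p} → Prime p → ¬ p ∣ 1
prime∤1 pp p∣1 = ¬prime[1] (subst Prime (∣1⇒≡1 p∣1) pp)

prime∣prime⇒≡ : ∀ {p q} → Prime p → Prime q → p ∣ q → p ≡ q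
prime∣prime⇒≡ pp pq p∣q with prime⇒irreducible pq p∣q
... | inj₁ refl = contradiction pp ¬prime[1]
... | inj₂ p≡q = p≡q

prime∣^⇒∣ : ∀ {p m} n → Prime p → p ∣ m ^ n → p ∣ m
prime∣^⇒∣ zero pp p∣1 = contradiction p∣1 (prime∤1 pp)
prime∣^⇒∣ {m = m} (suc n) pp p∣mⁿ⁺¹ with euclidsLemma m (m ^ n) pp p∣mⁿ⁺¹
... | inj₁ p∣m = p∣m
... | inj₂ p∣mⁿ = prime∣^⇒∣ n pp p∣mⁿ

prime∣n!⇒≤ : ∀ {p} n → Prime p → p ∣ n ! → p ≤ n
prime∣n!⇒≤ zero pp p∣1 = contradiction p∣1 (prime∤1 pp)
prime∣n!⇒≤ (suc n) pp p∣n! with euclidsLemma (suc n) (n !) pp p∣n!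
... | inj₁ p∣1+n = ∣⇒≤ p∣1+n
... | inj₂ p∣n! = m≤n⇒m≤1+n (prime∣n!⇒≤ n pp p∣n!)

leastPrimeDivisor : ∀ n → 2 ≤ n → ∃[ p ] (Prime p × p ∣ n × p Rough n)
leastPrimeDivisor n 2≤n = search 2 (n ∸ 2) (m+[n∸m]≡n 2≤n) ≤-refl 2-rough
  where
  search : ∀ m j → m + j ≡ n → 2 ≤ m → m Rough n → ∃[ p ] (Prime p × p ∣ n × p Rough n)
  search m j _ 2≤m rough with m ∣? n
  ... | yes m∣n = m , rough∧∣⇒prime {{n>1⇒nonTrivial 2≤m}} rough m∣n , m∣n , rough
  search m zero m+0≡n _ _ | no m∤n = contradiction (∣-reflexive (trans (sym (+-identityʳ m)) m+0≡n)) m∤n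
  search m (suc j) m+1+j≡n 2≤m rough | no m∤n =
    search (suc m) j (trans (sym (+-suc m j)) m+1+j≡n) (m≤n⇒m≤1+n 2≤m) (∤⇒rough-suc m∤n rough)

rough∧prime∣⇒≤ : ∀ {p n r} → p Rough n → Prime r → r ∣ n → p ≤ r
rough∧prime∣⇒≤ rough pr r∣n = rough⇒≤ {{prime⇒nonTrivial pr}} (rough∧∣⇒rough rough r∣n)

prime∤⇒coprime-^ : ∀ {p m} n → Prime p → ¬ p ∣ m → Coprime m (p ^ n)
prime∤⇒coprime-^ {p} n pp p∤m {zero} (_ , 0∣pⁿ) =
  contradiction (0∣⇒≡0 0∣pⁿ) (≢-nonZero⁻¹ (p ^ n) {{m^n≢0 p n {{prime⇒nonZero pp}}}})
prime∤⇒coprime-^ n pp p∤m {1} _ = refl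
prime∤⇒coprime-^ {p} n pp p∤m {i@(suc (suc _))} (i∣m , i∣pⁿ) with leastPrimeDivisor i (s≤s (s≤s z≤n))
... | r , pr , r∣i , _ = contradiction (subst (_∣ _) r≡p (∣-trans r∣i i∣m)) p∤m
  where
  r≡p : r ≡ p
  r≡p = prime∣prime⇒≡ pr pp (prime∣^⇒∣ n pr (∣-trans r∣i i∣pⁿ))

-- If x g = 1 + y m then x inverts g modulo m, and s ≡ -x r is written x (m-1) r to stay in ℕ.
coprime⇒∃∣*+ : ∀ {g m} → .{{NonZero m}} → Coprime g m → ∀ r → ∃[ s ] m ∣ g * s + r
coprime⇒∃∣*+ {g} {suc m} cop r with coprime-Bézout cop
... | Bézout.+- x y 1+y[1+m]≡xg = x * (m * r) , divides (r + y * m * r) (begin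
      g * (x * (m * r)) + r          ≡⟨ solve (g ∷ x ∷ m ∷ r ∷ []) ⟩
      x * g * (m * r) + r            ≡⟨ cong (λ z → z * (m * r) + r) 1+y[1+m]≡xg ⟨
      (1 + y * suc m) * (m * r) + r  ≡⟨ solve (y ∷ m ∷ r ∷ []) ⟩
      (r + y * m * r) * suc m        ∎)
  where open ≡-Reasoning
... | Bézout.-+ x y 1+xg≡y[1+m] = x * r , divides (r * y) (begin
      g * (x * r) + r  ≡⟨ solve (g ∷ x ∷ r ∷ []) ⟩
      (1 + x * g) * r  ≡⟨ cong (_* r) 1+xg≡y[1+m] ⟩
      y * suc m * r    ≡⟨ solve (y ∷ m ∷ r ∷ []) ⟩
      r * y * suc m    ∎)
  where open ≡-Reasoning

-- The divisibility hypothesis says X ≡ Q (mod q Q).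
∣+*∸1⇒≡*[1+*] : ∀ {X Q q} → .{{NonZero q}} → 1 ≤ X → q * Q ∣ X + Q * (q ∸ 1) →
                 ∃[ z ] X ≡ Q * (1 + z * q)
∣+*∸1⇒≡*[1+*] {X} {Q} {suc r} 1≤X (divides zero X+Qr≡0) =
  contradiction (m+n≡0⇒m≡0 X X+Qr≡0) (≢-nonZero⁻¹ X {{>-nonZero 1≤X}})
∣+*∸1⇒≡*[1+*] {X} {Q} {suc r} 1≤X (divides (suc z) X+Qr≡[1+z][1+r]Q) =
  z , +-cancelʳ-≡ (Q * r) X (Q * (1 + z * suc r)) (begin
    X + Q * r                    ≡⟨ X+Qr≡[1+z][1+r]Q ⟩
    suc z * (suc r * Q)          ≡⟨ solve (z ∷ r ∷ Q ∷ []) ⟩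
    Q * (1 + z * suc r) + Q * r  ∎)
  where open ≡-Reasoning

-- Two of the t + 1 points 0, …, t are roots of the same a i x + b i, so p divides a i times
-- their difference, which lies strictly between 0 and p.
linearRootsDoNotCover : ∀ {p t} (a b : ℕ → ℕ) → Prime p → t < p → (∀ {i} → i < t → ¬ p ∣ a i) →
                        ¬ (∀ x → ∃[ i ] (i < t × p ∣ a i * x + b i))
linearRootsDoNotCover {p} {t} a b pp t<p p∤a cover = collide (Fin.pigeonhole (n<1+n t) root)
  where
  i : ℕ → ℕ
  i x = proj₁ (cover x)
  i<t : ∀ x → i x < t
  i<t x = proj₁ (proj₂ (cover x))
  p∣b+a*x : ∀ x → p ∣ b (i x) + a (i x) * x
  p∣b+a*x x = subst (p ∣_) (+-comm (a (i x) * x) (b (i x))) (proj₂ (proj₂ (cover x)))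
  root : Fin (suc t) → Fin t
  root x = Fin.fromℕ< (i<t (Fin.toℕ x))
  collide : ¬ (∃₂ λ x x′ → x Fin.< x′ × root x ≡ root x′)
  collide (x , x′ , X<X′ , rootx≡rootx′) =
    [ p∤a (i<t X) , (λ p∣∣X-X′∣ → <⇒≱ t<p (≤-trans (∣∣m-n∣⇒≤m⊔n (<⇒≢ X<X′) p∣∣X-X′∣) X⊔X′≤t)) ]′
      (euclidsLemma (a (i X)) ∣ X - X′ ∣ pp p∣a∣X-X′∣)
    where
    X = Fin.toℕ x
    X′ = Fin.toℕ x′
    X⊔X′≤t : X ⊔ X′ ≤ t
    X⊔X′≤t = ⊔-lub (s≤s⁻¹ (Fin.toℕ<n x)) (s≤s⁻¹ (Fin.toℕ<n x′))
    iX≡iX′ : i X ≡ i X′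
    iX≡iX′ = trans (sym (Fin.toℕ-fromℕ< _)) (trans (cong Fin.toℕ rootx≡rootx′) (Fin.toℕ-fromℕ< _))
    p∣a∣X-X′∣ : p ∣ a (i X) * ∣ X - X′ ∣
    p∣a∣X-X′∣ = subst (p ∣_) (sym (*-distribˡ-∣-∣ (a (i X)) X X′))
      (∣o+m∣o+n⇒∣∣m-n∣ (b (i X)) (p∣b+a*x X) (subst (λ j → p ∣ b j + a j * X′) (sym iX≡iX′) (p∣b+a*x X′)))

evalFact-++ : ∀ F G → evalFact (F ++ G) ≡ evalFact F * evalFact G
evalFact-++ [] G = sym (+-identityʳ (evalFact G))
evalFact-++ ((p , a) ∷ F) G = trans (cong (p ^ a *_) (evalFact-++ F G)) (sym (*-assoc (p ^ a) _ _))

φFact-++ : ∀ B F G → φFact B (F ++ G) ≡ φFact B F + φFact B G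
φFact-++ B [] G = refl
φFact-++ B ((p , a) ∷ F) G =
  trans (cong (δ B p + δ′ B a +_) (φFact-++ B F G)) (sym (+-assoc (δ B p + δ′ B a) _ _))

factorisation⇒∣ : ∀ {n F} → IsPrimePowerFactorisation n F → All (λ pa → proj₁ pa ∣ n) F
factorisation⇒∣ {F = []} _ = All.[]
factorisation⇒∣ {F = (p , suc a) ∷ F} ((_ , s≤s z≤n) All.∷ primes , linked , refl) =
  ∣m⇒∣m*n (evalFact F) (m∣m*n (p ^ a)) All.∷
  All.map (∣n⇒∣m*n (p ^ suc a)) (factorisation⇒∣ (primes , Linked.tail linked , refl))

factorisation-++ : ∀ {m n F G} → IsPrimePowerFactorisation m F → IsPrimePowerFactorisation n G →
                   Connected _<ₚ_ (last F) (head G) → IsPrimePowerFactorisation (m * n) (F ++ G)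
factorisation-++ {F = F} {G} (primesF , linkedF , refl) (primesG , linkedG , refl) F<G =
  Allₚ.++⁺ primesF primesG , Linkedₚ.++⁺ linkedF F<G linkedG , evalFact-++ F G

Linked-<ₚ-exponent : ∀ {p a b F} → Linked _<ₚ_ ((p , a) ∷ F) → Linked _<ₚ_ ((p , b) ∷ F)
Linked-<ₚ-exponent Linked.[-] = Linked.[-]
Linked-<ₚ-exponent (p<q Linked.∷ linked) = p<q Linked.∷ linked

prime*-factorisation : ∀ {p m} → Prime p → p Rough m →
                       ∃[ F ] IsPrimePowerFactorisation m F → ∃[ G ] IsPrimePowerFactorisation (p * m) G
prime*-factorisation {p} pp _ ([] , _ , _ , refl) =
  (p , 1) ∷ [] , (pp , ≤-refl) All.∷ All.[] , Linked.[-] , *-identityʳ (p * 1)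
prime*-factorisation {p} pp rough (F@((r , a) ∷ F′) , isF@(primes , linked , refl)) with r ≟ p
... | yes refl = (p , suc a) ∷ F′ , (pp , s≤s z≤n) All.∷ All.tail primes , Linked-<ₚ-exponent linked ,
                 *-assoc p (p ^ a) (evalFact F′)
... | no r≢p = (p , 1) ∷ F , (pp , ≤-refl) All.∷ primes , p<r Linked.∷ linked ,
               cong (_* evalFact F) (*-identityʳ p)
  where
  p<r : p < r
  p<r = ≤∧≢⇒< (rough∧prime∣⇒≤ rough (proj₁ (All.head primes)) (All.head (factorisation⇒∣ isF)))
               (r≢p ∘ sym)

primePowerFactorisation : ∀ n → .{{NonZero n}} → ∃[ F ] IsPrimePowerFactorisation n F
primePowerFactorisation = <-rec (λ n → .{{NonZero n}} → ∃[ F ] IsPrimePowerFactorisation n F) factorise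
  where
  factorise : ∀ n → (∀ {m} → m < n → .{{NonZero m}} → ∃[ F ] IsPrimePowerFactorisation m F) →
              .{{NonZero n}} → ∃[ F ] IsPrimePowerFactorisation n F
  factorise 1 _ = [] , All.[] , Linked.[] , refl
  factorise n@(suc (suc _)) rec with leastPrimeDivisor n (s≤s (s≤s z≤n))
  ... | p , pp , divides zero () , _
  ... | p , pp , divides m@(suc _) n≡m*p , p-rough-n =
    subst (λ k → ∃[ F ] IsPrimePowerFactorisation k F) (trans (*-comm p m) (sym n≡m*p))
      (prime*-factorisation pp (rough∧∣⇒rough p-rough-n (divides p (trans n≡m*p (*-comm m p))))
        (rec (subst (m <_) (sym n≡m*p) (m<m*n m p (prime⇒2≤ pp)))))

eval-ℕ : ∀ a b x → eval (a , ℤ.+ b) (ℤ.+ x) ≡ ℤ.+ (a * x + b)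
eval-ℕ a b x = trans (cong (ℤ._+ ℤ.+ b) (sym (ℤ.pos-* a x))) (sym (ℤ.pos-+ (a * x) b))

primeAbove : DicksonConjecture → ∀ M → ∃[ p ] (M < p × Prime p)
primeAbove dickson M with dickson [x] (s≤s z≤n All.∷ All.[]) noFixedDivisor M
  where
  [x] : List Linear
  [x] = (1 , ℤ.+ 0) ∷ []
  noFixedDivisor : ¬ (∃[ m ] (1 < m × ((x : ℤ) → ℤ.+ m ℤ.∣ productAt [x] x)))
  noFixedDivisor (m , 1<m , m∣) = <⇒≢ 1<m (sym (∣1⇒≡1 (m∣ (ℤ.+ 1))))
... | x , M<x , (p , pp , x≡p) All.∷ All.[] = x , M<x , subst Prime (sym x≡p′) pp
  where
  x≡p′ : x ≡ p
  x≡p′ = trans (sym (trans (+-identityʳ (1 * x)) (*-identityˡ x)))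
               (ℤ.+-injective (trans (sym (eval-ℕ 1 0 x)) x≡p))

prime∣productAt⇒Any : ∀ {p} fs x → Prime p → p ∣ ℤ.∣ productAt fs x ∣ →
                      Any (λ f → p ∣ ℤ.∣ eval f x ∣) fs
prime∣productAt⇒Any [] x pp p∣1 = contradiction p∣1 (prime∤1 pp)
prime∣productAt⇒Any (f ∷ fs) x pp p∣∏
  with euclidsLemma _ _ pp (subst (_ ∣_) (ℤ.abs-* (eval f x) (productAt fs x)) p∣∏)
... | inj₁ p∣f = here p∣f
... | inj₂ p∣∏fs = there (prime∣productAt⇒Any fs x pp p∣∏fs)

δ′≤δ : ∀ B a → δ′ B a ≤ δ B a
δ′≤δ B zero = ≤-refl
δ′≤δ B (suc zero) = z≤n
δ′≤δ B (suc (suc a)) = ≤-refl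

module Digits (c : ℕ) where

  B : ℕ
  B = suc (suc c)

  1<B : 1 < B
  1<B = s≤s (s≤s z≤n)

  m<[1+m/B]*B : ∀ m → m < suc (m / B) * B
  m<[1+m/B]*B m = begin-strict
    m                  ≡⟨ m≡m%n+[m/n]*n m B ⟩
    m % B + m / B * B  <⟨ +-monoˡ-< (m / B * B) (m%n<n m B) ⟩
    suc (m / B) * B    ∎
    where open ≤-Reasoning

  digitsFuel-zero : ∀ f → digitsFuel (suc c) f 0 ≡ 0
  digitsFuel-zero zero = refl
  digitsFuel-zero (suc f) = refl

  digitsFuel-bounds : ∀ f m → .{{NonZero m}} → m ≤ f →
                      ∃[ d ] (digitsFuel (suc c) f m ≡ suc d × B ^ d ≤ m × m < B ^ suc d)
  digitsFuel-bounds (suc f) m@(suc m′) (s≤s m′≤f) with m / B in m/B≡u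
  ... | zero = 0 , cong suc (digitsFuel-zero f) , s≤s z≤n ,
               subst (m <_) (sym (*-identityʳ B)) (m/n≡0⇒m<n m/B≡u)
  ... | u@(suc _) with digitsFuel-bounds f u u≤f
    where
    u≤f : u ≤ f
    u≤f = ≤-trans (s≤s⁻¹ (subst (_< m) m/B≡u (m/n<m m B 1<B))) m′≤f
  ...   | d , digits≡1+d , Bᵈ≤u , u<B¹⁺ᵈ = suc d , cong suc digits≡1+d , Bᵈ⁺¹≤m , m<Bᵈ⁺²
    where
    open ≤-Reasoning
    Bᵈ⁺¹≤m : B ^ suc d ≤ m
    Bᵈ⁺¹≤m = begin
      B * B ^ d  ≤⟨ *-monoʳ-≤ B Bᵈ≤u ⟩
      B * u      ≡⟨ *-comm B u ⟩
      u * B      ≡⟨ cong (_* B) m/B≡u ⟨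
      m / B * B  ≤⟨ m/n*n≤m m B ⟩
      m          ∎
    m<Bᵈ⁺² : m < B ^ suc (suc d)
    m<Bᵈ⁺² = begin-strict
      m                <⟨ m<[1+m/B]*B m ⟩
      suc (m / B) * B  ≡⟨ cong (λ v → suc v * B) m/B≡u ⟩
      suc u * B        ≤⟨ *-monoˡ-≤ B u<B¹⁺ᵈ ⟩
      B ^ suc d * B    ≡⟨ *-comm (B ^ suc d) B ⟩
      B ^ suc (suc d)  ∎

  δ-bounds : ∀ n → .{{NonZero n}} → ∃[ d ] (δ B n ≡ suc d × B ^ d ≤ n × n < B ^ suc d)
  δ-bounds n = digitsFuel-bounds n n ≤-refl

  ^≤⇒<δ : ∀ {j n} → B ^ j ≤ n → j < δ B n
  ^≤⇒<δ {j} {n} Bʲ≤n with δ-bounds n {{>-nonZero (≤-trans (m^n>0 B j) Bʲ≤n)}}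
  ... | d , δn≡1+d , _ , n<B¹⁺ᵈ = subst (j <_) (sym δn≡1+d) (^-cancelˡ-< B (≤-<-trans Bʲ≤n n<B¹⁺ᵈ))

  <^⇒δ≤ : ∀ {j n} → .{{NonZero n}} → n < B ^ j → δ B n ≤ j
  <^⇒δ≤ {j} {n} n<Bʲ with δ-bounds n
  ... | d , δn≡1+d , Bᵈ≤n , _ = subst (_≤ j) (sym δn≡1+d) (^-cancelˡ-< B (≤-<-trans Bᵈ≤n n<Bʲ))

  δ′[B^[1+n]]≤2+n : ∀ n → δ′ B (B ^ suc n) ≤ suc (suc n)
  δ′[B^[1+n]]≤2+n n =
    ≤-trans (δ′≤δ B (B ^ suc n)) (<^⇒δ≤ {{m^n≢0 B (suc n)}} (^-monoʳ-< B 1<B (n<1+n (suc n))))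

  e+δp≤δ[n*[q^e*p]] : ∀ {n q p} e → .{{_ : NonZero n}} → .{{p≢0 : NonZero p}} → B ≤ q →
                      e + δ B p ≤ δ B (n * (q ^ e * p))
  e+δp≤δ[n*[q^e*p]] {n} {q} {p} e B≤q with δ-bounds p
  ... | d , δp≡1+d , Bᵈ≤p , _ = begin
    e + δ B p              ≡⟨ trans (cong (e +_) δp≡1+d) (+-suc e d) ⟩
    suc (e + d)            ≤⟨ ^≤⇒<δ Bᵉ⁺ᵈ≤n*[qᵉ*p] ⟩
    δ B (n * (q ^ e * p))  ∎
    where
    open ≤-Reasoning
    Bᵉ⁺ᵈ≤n*[qᵉ*p] : B ^ (e + d) ≤ n * (q ^ e * p)
    Bᵉ⁺ᵈ≤n*[qᵉ*p] = begin
      B ^ (e + d)      ≡⟨ ^-distribˡ-+-* B e d ⟩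
      B ^ e * B ^ d    ≤⟨ *-mono-≤ (^-monoˡ-≤ e B≤q) Bᵈ≤p ⟩
      q ^ e * p        ≤⟨ m≤n*m (q ^ e * p) n ⟩
      n * (q ^ e * p)  ∎

  frugal-*^* : ∀ {n q p} k F → .{{NonZero n}} → IsPrimePowerFactorisation n F → Prime q → Prime p →
               n < q → q < p → B ≤ q → Frugal B k (n * (q ^ (B ^ suc (φFact B F + δ B q + k)) * p))
  frugal-*^* {n} {q} {p} k F isF pq pp n<q q<p B≤q =
    F ++ G , factorisation-++ isF isG (last<q (Allₚ.last⁺ (factorisation⇒∣ isF))) , (begin
      φFact B (F ++ G) + k                                ≡⟨ cong (_+ k) (φFact-++ B F G) ⟩
      φFact B F + (δ B q + δ′ B e + (δ B p + 0 + 0)) + k  ≡⟨ regroup (φFact B F) (δ B q) (δ′ B e) (δ B p) k ⟩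
      C + δ′ B e + δ B p                                  ≤⟨ +-monoˡ-≤ (δ B p) (+-monoʳ-≤ C (δ′[B^[1+n]]≤2+n C)) ⟩
      C + suc (suc C) + δ B p                             ≡⟨ cong (_+ δ B p) (n+[2+n]≡2*[1+n] C) ⟩
      2 * suc C + δ B p                                   ≤⟨ +-monoˡ-≤ (δ B p) (2*[1+n]≤m^[1+n] C 1<B) ⟩
      e + δ B p                                           ≤⟨ e+δp≤δ[n*[q^e*p]] e {{p≢0 = prime⇒nonZero pp}} B≤q ⟩
      δ B (n * (q ^ e * p))                               ∎)
    where
    C = φFact B F + δ B q + k
    e = B ^ suc C
    G : List PrimePower
    G = (q , e) ∷ (p , 1) ∷ []
    isG : IsPrimePowerFactorisation (q ^ e * p) G
    isG = (pq , m^n>0 B (suc C)) All.∷ (pp , ≤-refl) All.∷ All.[] , q<p Linked.∷ Linked.[-] ,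
          cong (q ^ e *_) (trans (*-identityʳ (p * 1)) (*-identityʳ p))
    last<q : ∀ {x} → Maybe.All (λ pa → proj₁ pa ∣ n) x → Connected _<ₚ_ x (head G)
    last<q (Maybe.just r∣n) = just (≤-<-trans (∣⇒≤ r∣n) n<q)
    last<q Maybe.nothing = nothing-just
    regroup : ∀ a b c d k → a + (b + c + (d + 0 + 0)) + k ≡ a + b + k + c + d
    regroup a b c d k = solve (a ∷ b ∷ c ∷ d ∷ k ∷ [])
    n+[2+n]≡2*[1+n] : ∀ n → n + suc (suc n) ≡ 2 * suc n
    n+[2+n]≡2*[1+n] n = solve (n ∷ [])
    open ≤-Reasoning

module Construction (dickson : DicksonConjecture) (c k t : ℕ) where
  open Digits c

  q : ℕ → ℕ
  q zero = proj₁ (primeAbove dickson (t + B))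
  q (suc j) = proj₁ (primeAbove dickson (q j))

  q-prime : ∀ j → Prime (q j)
  q-prime zero = proj₂ (proj₂ (primeAbove dickson (t + B)))
  q-prime (suc j) = proj₂ (proj₂ (primeAbove dickson (q j)))

  t+B<q : ∀ j → t + B < q j
  t+B<q zero = proj₁ (proj₂ (primeAbove dickson (t + B)))
  t+B<q (suc j) = <-trans (t+B<q j) (proj₁ (proj₂ (primeAbove dickson (q j))))

  q-strictMono : ∀ {i j} → i < j → q i < q j
  q-strictMono {i} {suc j} i<1+j with m<1+n⇒m<n∨m≡n i<1+j
  ... | inj₁ i<j = <-trans (q-strictMono i<j) (proj₁ (proj₂ (primeAbove dickson (q j))))
  ... | inj₂ refl = proj₁ (proj₂ (primeAbove dickson (q j)))

  t<q : ∀ j → t < q j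
  t<q j = ≤-<-trans (m≤m+n t B) (t+B<q j)

  B≤q : ∀ j → B ≤ q j
  B≤q j = <⇒≤ (≤-<-trans (m≤n+m B t) (t+B<q j))

  q≢0 : ∀ j → NonZero (q j)
  q≢0 j = prime⇒nonZero (q-prime j)

  T D : ℕ
  T = t !
  D = T * T

  d : ℕ → ℕ
  d i = T * (T / suc i)

  [1+i]*d≡D : ∀ {i} → i < t → suc i * d i ≡ D
  [1+i]*d≡D {i} i<t = begin
    suc i * (T * (T / suc i))  ≡⟨ x∙yz≈y∙xz (suc i) T (T / suc i) ⟩
    T * (suc i * (T / suc i))  ≡⟨ cong (T *_) (m*[n/m]≡n (m≤n⇒m∣n! i<t)) ⟩
    D                          ∎
    where open ≡-Reasoning

  T∣d : ∀ i → T ∣ d i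
  T∣d i = m∣m*n (T / suc i)

  d∣D : ∀ {i} → i < t → d i ∣ D
  d∣D {i} i<t = divides (suc i) (sym ([1+i]*d≡D i<t))

  prime∣D⇒∣T : ∀ {p} → Prime p → p ∣ D → p ∣ T
  prime∣D⇒∣T pp p∣D = [ id , id ]′ (euclidsLemma T T pp p∣D)

  q∤D : ∀ j → ¬ q j ∣ D
  q∤D j q∣D = <⇒≱ (t<q j) (prime∣n!⇒≤ t (q-prime j) (prime∣D⇒∣T (q-prime j) q∣D))

  F : ℕ → List PrimePower
  F i = proj₁ (primePowerFactorisation (suc i))

  F-factorises : ∀ i → IsPrimePowerFactorisation (suc i) (F i)
  F-factorises i = proj₂ (primePowerFactorisation (suc i))

  e Q : ℕ → ℕ
  e i = B ^ suc (φFact B (F i) + δ B (q i) + k)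
  Q i = q i ^ e i

  Q≢0 : ∀ i → NonZero (Q i)
  Q≢0 i = m^n≢0 (q i) (e i) {{q≢0 i}}

  q∣Q : ∀ i → q i ∣ Q i
  q∣Q i = m∣m^n (q i) {{m^n≢0 B (suc (φFact B (F i) + δ B (q i) + k))}}

  M : ℕ → ℕ
  M zero = 1
  M (suc n) = M n * q n ^ suc (e n)

  prime∣M⇒≡q : ∀ n {p} → Prime p → p ∣ M n → ∃[ j ] (j < n × p ≡ q j)
  prime∣M⇒≡q zero pp p∣1 = contradiction p∣1 (prime∤1 pp)
  prime∣M⇒≡q (suc n) pp p∣M with euclidsLemma (M n) (q n ^ suc (e n)) pp p∣M
  ... | inj₁ p∣Mn = let j , j<n , p≡qj = prime∣M⇒≡q n pp p∣Mn in j , m<n⇒m<1+n j<n , p≡qj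
  ... | inj₂ p∣qⁿ = n , ≤-refl , prime∣prime⇒≡ pp (q-prime n) (prime∣^⇒∣ (suc (e n)) pp p∣qⁿ)

  q^[1+e]∣M : ∀ {i n} → i < n → q i ^ suc (e i) ∣ M n
  q^[1+e]∣M {i} {suc n} i<1+n with m<1+n⇒m<n∨m≡n i<1+n
  ... | inj₁ i<n = ∣m⇒∣m*n (q n ^ suc (e n)) (q^[1+e]∣M i<n)
  ... | inj₂ refl = n∣m*n (M n)

  q∤d*M : ∀ {n} → n < t → ¬ q n ∣ d n * M n
  q∤d*M {n} n<t q∣dM with euclidsLemma (d n) (M n) (q-prime n) q∣dM
  ... | inj₁ q∣d = q∤D n (∣-trans q∣d (d∣D n<t))
  ... | inj₂ q∣M with prime∣M⇒≡q n (q-prime n) q∣M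
  ...   | j , j<n , qn≡qj = <-irrefl (sym qn≡qj) (q-strictMono j<n)

  -- d i * y + 1 ≡ Q i (mod q i * Q i): the power of q i dividing d i * y + 1 is exactly Q i.
  ExactPower : ℕ → ℕ → Set
  ExactPower y i = q i ^ suc (e i) ∣ d i * y + 1 + Q i * (q i ∸ 1)

  chineseRemainder : ∀ n → n ≤ t → ∃[ y ] (∀ {i} → i < n → ExactPower y i)
  chineseRemainder zero _ = 0 , λ ()
  chineseRemainder (suc n) n<t with chineseRemainder n (<⇒≤ n<t)
  ... | y , targets
      with coprime⇒∃∣*+ {{m^n≢0 (q n) (suc (e n)) {{q≢0 n}}}}
             (prime∤⇒coprime-^ (suc (e n)) (q-prime n) (q∤d*M n<t)) (d n * y + 1 + Q n * (q n ∸ 1))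
  ...   | s , hit = y + M n * s , targets′
    where
    shift : ∀ d y M s r → d * (y + M * s) + 1 + r ≡ d * y + 1 + r + M * (d * s)
    shift d y M s r = solve (d ∷ y ∷ M ∷ s ∷ r ∷ [])
    shift′ : ∀ d y M s r → d * (y + M * s) + 1 + r ≡ d * M * s + (d * y + 1 + r)
    shift′ d y M s r = solve (d ∷ y ∷ M ∷ s ∷ r ∷ [])
    targets′ : ∀ {i} → i < suc n → ExactPower (y + M n * s) i
    targets′ {i} i<1+n with m<1+n⇒m<n∨m≡n i<1+n
    ... | inj₁ i<n = subst (q i ^ suc (e i) ∣_) (sym (shift (d i) y (M n) s (Q i * (q i ∸ 1))))
                       (∣m∣n⇒∣m+n (targets i<n) (∣m⇒∣m*n (d i * s) (q^[1+e]∣M i<n)))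
    ... | inj₂ refl = subst (q i ^ suc (e i) ∣_) (sym (shift′ (d i) y (M i) s (Q i * (q i ∸ 1)))) hit

  y₀ : ℕ
  y₀ = proj₁ (chineseRemainder t ≤-refl)

  d*y₀+1≡Q*[1+z*q] : ∀ {i} → i < t → ∃[ z ] d i * y₀ + 1 ≡ Q i * (1 + z * q i)
  d*y₀+1≡Q*[1+z*q] {i} i<t =
    ∣+*∸1⇒≡*[1+*] {{q≢0 i}} (m≤n+m 1 (d i * y₀)) (proj₂ (chineseRemainder t ≤-refl) i<t)

  a b : ℕ → ℕ
  a i = (d i * M t / Q i) {{Q≢0 i}}
  b i = ((d i * y₀ + 1) / Q i) {{Q≢0 i}}

  Q*a≡d*M : ∀ {i} → i < t → Q i * a i ≡ d i * M t
  Q*a≡d*M {i} i<t = m*[n/m]≡n {{Q≢0 i}} (∣-trans (n∣m*n (q i)) (∣n⇒∣m*n (d i) (q^[1+e]∣M i<t)))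

  Q*b≡d*y₀+1 : ∀ {i} → i < t → Q i * b i ≡ d i * y₀ + 1
  Q*b≡d*y₀+1 {i} i<t with d*y₀+1≡Q*[1+z*q] i<t
  ... | z , eq = m*[n/m]≡n {{Q≢0 i}} (divides (1 + z * q i) (trans eq (*-comm (Q i) _)))

  q∤b : ∀ {i} → i < t → ¬ q i ∣ b i
  q∤b {i} i<t q∣b with d*y₀+1≡Q*[1+z*q] i<t
  ... | z , eq = prime∤1 (q-prime i) (∣m+n∣m⇒∣n (subst (q i ∣_) b≡z*q+1 q∣b) (n∣m*n z))
    where
    b≡z*q+1 : b i ≡ z * q i + 1
    b≡z*q+1 = trans (*-cancelˡ-≡ (b i) (1 + z * q i) (Q i) {{Q≢0 i}} (trans (Q*b≡d*y₀+1 i<t) eq))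
                    (+-comm 1 (z * q i))

  f : ℕ → ℕ → ℕ
  f i x = a i * x + b i

  N : ℕ → ℕ
  N x = D * (y₀ + M t * x) + 1

  N+i≡[1+i]*Q*f : ∀ {i} x → i < t → N x + i ≡ suc i * (Q i * f i x)
  N+i≡[1+i]*Q*f {i} x i<t = begin
    D * (y₀ + M t * x) + 1 + i                     ≡⟨ +-assoc (D * (y₀ + M t * x)) 1 i ⟩
    D * (y₀ + M t * x) + suc i                     ≡⟨ cong (λ v → v * (y₀ + M t * x) + suc i) ([1+i]*d≡D i<t) ⟨
    suc i * d i * (y₀ + M t * x) + suc i           ≡⟨ expand (suc i) (d i) y₀ (M t) x ⟩
    suc i * (d i * M t * x + (d i * y₀ + 1))       ≡⟨ cong₂ (λ u v → suc i * (u * x + v)) (Q*a≡d*M i<t) (Q*b≡d*y₀+1 i<t) ⟨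
    suc i * (Q i * a i * x + Q i * b i)            ≡⟨ cong (suc i *_) (factor (Q i) (a i) x (b i)) ⟩
    suc i * (Q i * (a i * x + b i))                ∎
    where
    open ≡-Reasoning
    expand : ∀ n d y M x → n * d * (y + M * x) + n ≡ n * (d * M * x + (d * y + 1))
    expand n d y M x = solve (n ∷ d ∷ y ∷ M ∷ x ∷ [])
    factor : ∀ Q a x b → Q * a * x + Q * b ≡ Q * (a * x + b)
    factor Q a x b = solve (Q ∷ a ∷ x ∷ b ∷ [])

  prime∣f⇒∣N+i : ∀ {p i} x → i < t → p ∣ f i x → p ∣ N x + i
  prime∣f⇒∣N+i {p} {i} x i<t p∣f =
    subst (p ∣_) (sym (N+i≡[1+i]*Q*f x i<t)) (∣n⇒∣m*n (suc i) (∣n⇒∣m*n (Q i) p∣f))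

  q∣N+i : ∀ {i} x → i < t → q i ∣ N x + i
  q∣N+i {i} x i<t = subst (q i ∣_) (sym (N+i≡[1+i]*Q*f x i<t))
    (∣n⇒∣m*n (suc i) (∣m⇒∣m*n (f i x) (q∣Q i)))

  M≢0 : ∀ n → NonZero (M n)
  M≢0 zero = _
  M≢0 (suc n) = m*n≢0 (M n) (q n ^ suc (e n)) {{M≢0 n}} {{m^n≢0 (q n) (suc (e n)) {{q≢0 n}}}}

  d≢0 : ∀ {i} → i < t → NonZero (d i)
  d≢0 {i} i<t = m*n≢0⇒n≢0 (suc i) {{subst NonZero (sym ([1+i]*d≡D i<t)) (t !* t !≢0)}}

  1≤a : ∀ {i} → i < t → 1 ≤ a i
  1≤a {i} i<t = >-nonZero⁻¹ (a i) {{m*n≢0⇒n≢0 (Q i) {{Q*a≢0}}}}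
    where
    Q*a≢0 : NonZero (Q i * a i)
    Q*a≢0 = subst NonZero (sym (Q*a≡d*M i<t)) (m*n≢0 (d i) (M t) {{d≢0 i<t}} {{M≢0 t}})

  f[0]≡b : ∀ i → f i 0 ≡ b i
  f[0]≡b i = cong (_+ b i) (*-zeroʳ (a i))

  prime∣D*M⇒∤f[0] : ∀ {p i} → Prime p → p ∣ D * M t → i < t → ¬ p ∣ f i 0
  prime∣D*M⇒∤f[0] {p} {i} pp p∣DM i<t p∣f0 with euclidsLemma D (M t) pp p∣DM
  ... | inj₁ p∣D = prime∤1 pp (∣m+n∣m⇒∣n p∣d*y₀+1 (∣m⇒∣m*n y₀ (∣-trans (prime∣D⇒∣T pp p∣D) (T∣d i))))
    where
    p∣d*y₀+1 : p ∣ d i * y₀ + 1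
    p∣d*y₀+1 = subst (p ∣_) (Q*b≡d*y₀+1 i<t) (∣n⇒∣m*n (Q i) (subst (p ∣_) (f[0]≡b i) p∣f0))
  ... | inj₂ p∣M with prime∣M⇒≡q t pp p∣M
  ...   | j , j<t , refl with i ≟ j
  ...     | yes refl = q∤b i<t (subst (q i ∣_) (f[0]≡b i) p∣f0)
  -- q j would divide both N 0 + i and N 0 + j.
  ...     | no i≢j = <⇒≱ (t<q j) (<⇒≤ (≤-<-trans (∣∣m-n∣⇒≤m⊔n i≢j qj∣∣i-j∣) (⊔-lub i<t j<t)))
    where
    qj∣∣i-j∣ : q j ∣ ∣ i - j ∣
    qj∣∣i-j∣ = ∣o+m∣o+n⇒∣∣m-n∣ (N 0) (prime∣f⇒∣N+i 0 i<t p∣f0) (q∣N+i 0 j<t)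

  prime∤D*M⇒∤a : ∀ {p i} → ¬ p ∣ D * M t → i < t → ¬ p ∣ a i
  prime∤D*M⇒∤a {p} {i} p∤DM i<t p∣a =
    p∤DM (∣-trans (subst (p ∣_) (Q*a≡d*M i<t) (∣n⇒∣m*n (Q i) p∣a)) (*-monoˡ-∣ (M t) (d∣D i<t)))

  prime∤D*M⇒t<p : ∀ {p} → Prime p → ¬ p ∣ D * M t → t < p
  prime∤D*M⇒t<p pp p∤DM =
    ≰⇒> (λ p≤t → p∤DM (∣m⇒∣m*n (M t) (∣m⇒∣m*n T (m≤n⇒m∣n! {{prime⇒nonZero pp}} p≤t))))

  ¬∀∃prime∣f : ∀ {p} → Prime p → ¬ (∀ x → ∃[ i ] (i < t × p ∣ f i x))
  ¬∀∃prime∣f {p} pp cover with p ∣? D * M t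
  ... | yes p∣DM = let i , i<t , p∣f0 = cover 0 in prime∣D*M⇒∤f[0] pp p∣DM i<t p∣f0
  ... | no p∤DM = linearRootsDoNotCover a b pp (prime∤D*M⇒t<p pp p∤DM) (prime∤D*M⇒∤a p∤DM) cover

  family : List Linear
  family = applyUpTo (λ i → a i , ℤ.+ b i) t

  prime∣family⇒∃prime∣f : ∀ {p} → Prime p → (∀ x → p ∣ ℤ.∣ productAt family (ℤ.+ x) ∣) →
                          ∀ x → ∃[ i ] (i < t × p ∣ f i x)
  prime∣family⇒∃prime∣f {p} pp p∣∏ x with find (prime∣productAt⇒Any family (ℤ.+ x) pp (p∣∏ x))
  ... | _ , g∈family , p∣g with ∈-applyUpTo⁻ (λ i → a i , ℤ.+ b i) g∈family
  ...   | i , i<t , refl = i , i<t , subst (λ v → p ∣ ℤ.∣ v ∣) (eval-ℕ (a i) (b i) x) p∣g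

  noFixedDivisor : ¬ (∃[ m ] (1 < m × ((x : ℤ) → ℤ.+ m ℤ.∣ productAt family x)))
  noFixedDivisor (m , 1<m , m∣∏) with leastPrimeDivisor m 1<m
  ... | p , pp , p∣m , _ = ¬∀∃prime∣f pp (prime∣family⇒∃prime∣f pp (λ x → ∣-trans p∣m (m∣∏ (ℤ.+ x))))

  frugal-N+i : ∀ {x i} → q t < x → IsPrimeℤ (eval (a i , ℤ.+ b i) (ℤ.+ x)) → i < t →
               Frugal B k (N x + i)
  frugal-N+i {x} {i} qt<x (p , pp , fx≡p) i<t = subst (Frugal B k) (sym N+i≡[1+i]*Q*p)
    (frugal-*^* k (F i) (F-factorises i) (q-prime i) pp (≤-<-trans i<t (t<q i)) qi<p (B≤q i))
    where
    f≡p : f i x ≡ p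
    f≡p = ℤ.+-injective (trans (sym (eval-ℕ (a i) (b i) x)) fx≡p)
    N+i≡[1+i]*Q*p : N x + i ≡ suc i * (Q i * p)
    N+i≡[1+i]*Q*p = trans (N+i≡[1+i]*Q*f x i<t) (cong (λ v → suc i * (Q i * v)) f≡p)
    qi<p : q i < p
    qi<p = begin-strict
      q i      <⟨ q-strictMono i<t ⟩
      q t      <⟨ qt<x ⟩
      x        ≤⟨ m≤n*m x (a i) {{>-nonZero (1≤a i<t)}} ⟩
      a i * x  ≤⟨ m≤m+n (a i * x) (b i) ⟩
      f i x    ≡⟨ f≡p ⟩
      p        ∎
      where open ≤-Reasoning

mainTheorem5 : DicksonConjecture →
    (B : ℕ) → 2 ≤ B → (k : ℕ) → (t : ℕ) → 1 ≤ t →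
    ∃[ N ] (1 ≤ N × ((i : ℕ) → i < t → Frugal B k (N + i)))
mainTheorem5 dickson (suc (suc c)) (s≤s (s≤s z≤n)) k t _ =
  let x , qt<x , primes = dickson family (Allₚ.applyUpTo⁺₁ _ t 1≤a) noFixedDivisor (q t)
  in  N x , m≤n+m 1 _ , λ i i<t → frugal-N+i qt<x (Allₚ.applyUpTo⁻ _ t primes i<t) i<t
  where open Construction dickson c k t
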